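{- Let $D$ be an $n\times n$ demand matrix with nonnegative integer entries, and run the greedy algorithm ALG, which at each time step $t=0,1,\dots$ transmits an arbitrary maximal fractional matching of the residual demand matrix $D(t)$, until all demand is transmitted at time $T$. Define $D^S_i(t)=\sum_j D_{ij}(t)$, $D^R_j(t)=\sum_i D_{ij}(t)$, and set, for all $i,j\in N$ and $0\le t\le T$, $\alpha^S_{ij}=D^S_i(0)$, $\alpha^R_{ij}=D^R_j(0)$, $\beta^S_{it}=\tfrac14 D^S_i(t)$, $\beta^R_{jt}=\tfrac14 D^R_j(t)$. Then \[ \Big(\sum_{i,j} D_{ij}\alpha^S_{ij}-\sum_{i}\sum_{t=0}^T\beta^S_{it}\Big)+\Big(\sum_{i,j} D_{ij}\alpha^R_{ij}-\sum_{j}\sum_{t=0}^T\beta^R_{jt}\Big)\ \ge\ \tfrac12\,\mathrm{ALG}, \] where $\mathrm{ALG}$ denotes the total completion time of the schedule produced by ALG.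
   Context: Nodes $N=\{0,\dots,n-1\}$; $D_{ij}$ is the amount of data to be sent directly from $i$ to $j$. A fractional matching in step $t$ is a nonnegative matrix $x$ with $x_{ij}$ the amount sent from $i$ to $j$ during $[t,t+1]$, with all row sums and column sums at most $1$. $D_{ij}(t)$ is the amount of data from $i$ to $j$ not yet transmitted by ALG at time $t$ (so $D(0)=D$). A fractional matching $x$ of the residual matrix $D(t)$ satisfies $x_{ij}\le D_{ij}(t)$; it is maximal if no entry can be increased while keeping $x_{ij}\le D_{ij}(t)$ and all row and column sums at most $1$. Data sent in step $[t-1,t]$ has completion time $t$; the total completion time is the sum (integral) of completion times over all data.
   Formalization: The fractional matchings transmitted by ALG, and hence the residual demand matrices $D(t)$, have rational rather than real entries. -}

module Defs where

open import Data.Nat as ℕ using (ℕ; zero; suc)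
open import Data.Fin using (Fin)
open import Data.Integer using (+_)
open import Data.Rational using (ℚ; 0ℚ; 1ℚ; ½; _+_; _-_; _*_; _≤_; _<_; _/_)
open import Data.Product using (Σ; _×_; ∃)
open import Data.Sum using (_⊎_)
open import Relation.Nullary using (¬_)
open import Relation.Binary.PropositionalEquality using (_≡_; _≢_)
open import Relation.Nullary.Decidable using (⌊_⌋)
open import Data.Fin using (_≟_)
open import Data.Bool using (if_then_else_; _∧_)

ℕ→ℚ : ℕ → ℚ
ℕ→ℚ k = + k / 1

¼ : ℚ
¼ = + 1 / 4

ΣFin : ∀ {n} → (Fin n → ℚ) → ℚ
ΣFin {zero}  f = 0ℚ
ΣFin {suc n} f = f Fin.zero + ΣFin {n} (λ i → f (Fin.suc i))

Σ< : ℕ → (ℕ → ℚ) → ℚ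
Σ< zero    f = 0ℚ
Σ< (suc m) f = Σ< m f + f m

Matrix : ℕ → Set
Matrix n = Fin n → Fin n → ℚ

rowSum : ∀ {n} → Matrix n → Fin n → ℚ
rowSum x i = ΣFin (λ j → x i j)

colSum : ∀ {n} → Matrix n → Fin n → ℚ
colSum x j = ΣFin (λ i → x i j)

IsFracMatchingOf : ∀ {n} → Matrix n → Matrix n → Set
IsFracMatchingOf {n} R x =
  ((i j : Fin n) → 0ℚ ≤ x i j) ×
  ((i j : Fin n) → x i j ≤ R i j) ×
  ((i : Fin n) → rowSum x i ≤ 1ℚ) ×
  ((j : Fin n) → colSum x j ≤ 1ℚ)

bump : ∀ {n} → Matrix n → Fin n → Fin n → ℚ → Matrix n
bump x i j ε k l = if ⌊ k ≟ i ⌋ ∧ ⌊ l ≟ j ⌋ then x k l + ε else x k l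

IsMaximalFracMatchingOf : ∀ {n} → Matrix n → Matrix n → Set
IsMaximalFracMatchingOf {n} R x =
  IsFracMatchingOf R x ×
  ((i j : Fin n) (ε : ℚ) → 0ℚ < ε → ¬ IsFracMatchingOf R (bump x i j ε))

-- A run of ALG: x t is the fractional matching transmitted during [t, t+1].
-- Residual demand D(t) = D − Σ_{s<t} x s.
Residual : ∀ {n} → (Fin n → Fin n → ℕ) → (ℕ → Matrix n) → ℕ → Matrix n
Residual D x t i j = ℕ→ℚ (D i j) - Σ< t (λ s → x s i j)

AllTransmitted : ∀ {n} → Matrix n → Set
AllTransmitted {n} R = (i j : Fin n) → R i j ≡ 0ℚ

IsGreedyRun : ∀ {n} → (Fin n → Fin n → ℕ) → (ℕ → Matrix n) → ℕ → Set
IsGreedyRun D x T =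
  ((t : ℕ) → t ℕ.< T → IsMaximalFracMatchingOf (Residual D x t) (x t)) ×
  AllTransmitted (Residual D x T) ×
  ((t : ℕ) → t ℕ.< T → ¬ AllTransmitted (Residual D x t))

-- total completion time: data sent during [t, t+1] completes at time t+1
ALGcost : ∀ {n} → (ℕ → Matrix n) → ℕ → ℚ
ALGcost x T = Σ< T (λ t → ℕ→ℚ (suc t) * ΣFin (λ i → ΣFin (λ j → x t i j)))

DS : ∀ {n} → (Fin n → Fin n → ℕ) → (ℕ → Matrix n) → ℕ → Fin n → ℚ
DS D x t i = rowSum (Residual D x t) i

DR : ∀ {n} → (Fin n → Fin n → ℕ) → (ℕ → Matrix n) → ℕ → Fin n → ℚ
DR D x t j = colSum (Residual D x t) j

{-# OPTIONS --safe #-}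
-- Let W_ij = Σ_t (t+1) x_t(i,j) be the total completion time of the (i,j) data, so ALG = Σ_ij W_ij.
-- Summation by parts gives Σ_{t≤T} D_ij(t) = W_ij, hence both β-sums equal ¼ ALG.
-- If x_t(i,j) > 0 then D_ij(s+1) > 0 for every s < t, so by maximality row i or column j of x_s
-- is full; summing over s, t ≤ (D^S_i(0) − D^S_i(t)) + (D^R_j(0) − D^R_j(t)) < α^S_ij + α^R_ij,
-- and integrality gives t + 1 ≤ α^S_ij + α^R_ij. Hence ALG ≤ Σ_ij D_ij α^S_ij + Σ_ij D_ij α^R_ij,
-- which with the two β-sums equal to ¼ ALG gives the claim.
module Submission where

open import Defs
open import Data.Fin as Fin using (Fin; _≟_)
open import Data.Fin.Properties using (suc-injective)
import Data.Integer as ℤ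
import Data.Integer.Properties as ℤ
open import Data.Nat as ℕ using (ℕ; zero; suc)
import Data.Nat.Properties as ℕ
import Data.Nat.Coprimality as Coprimality
open import Data.Product using (_,_; proj₁; proj₂)
open import Data.Rational
  using (ℚ; 0ℚ; 1ℚ; ½; _+_; _-_; -_; _*_; _≤_; _<_; _⊓_; _/_; mkℚ; *≤*; nonNegative)
open import Data.Rational.Properties hiding (_≟_)
open import Data.Rational.Solver using (module +-*-Solver)
open import Data.Sum using (_⊎_; inj₁; inj₂; [_,_])
open import Data.Vec.Functional using (foldr)
open import Function using (_∘_; flip)
open import Relation.Binary.PropositionalEquality
  using (_≡_; _≢_; refl; sym; trans; cong; cong₂; subst; subst₂; module ≡-Reasoning)
open import Relation.Nullary using (yes; no; contradiction)
open import Relation.Nullary.Decidable using (toSum)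

open +-*-Solver using (solve; _:+_; _:-_; _:*_; _:=_; con)

p-q≤p : ∀ p {q} → 0ℚ ≤ q → p - q ≤ p
p-q≤p p {q} 0≤q = subst (p - q ≤_) (+-identityʳ p) (+-monoʳ-≤ p (neg-antimono-≤ 0≤q))

p-q<p : ∀ p {q} → 0ℚ < q → p - q < p
p-q<p p {q} 0<q = subst (p - q <_) (+-identityʳ p) (+-monoʳ-< p (neg-antimono-< 0<q))

p<q⇒0<q-p : ∀ {p q} → p < q → 0ℚ < q - p
p<q⇒0<q-p {p} {q} p<q = subst (_< q - p) (+-inverseʳ p) (+-monoˡ-< (- p) p<q)

e≤q-p⇒p+e≤q : ∀ p {q e} → e ≤ q - p → p + e ≤ q
e≤q-p⇒p+e≤q p {q} e≤q-p =
  subst (p + _ ≤_) (solve 2 (λ p q → p :+ (q :- p) := q) refl p q) (+-monoʳ-≤ p e≤q-p)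

p-q≡0⇒p≡q : ∀ {p q} → p - q ≡ 0ℚ → p ≡ q
p-q≡0⇒p≡q {p} {q} p-q≡0 = begin
  p             ≡⟨ solve 2 (λ p q → p := (p :- q) :+ q) refl p q ⟩
  (p - q) + q   ≡⟨ cong (_+ q) p-q≡0 ⟩
  0ℚ + q        ≡⟨ +-identityˡ q ⟩
  q             ∎
  where open ≡-Reasoning

p≤p+q : ∀ p {q} → 0ℚ ≤ q → p ≤ p + q
p≤p+q p {q} 0≤q = subst (_≤ p + q) (+-identityʳ p) (+-monoʳ-≤ p 0≤q)

≤⇒≡⊎< : ∀ {p q} → p ≤ q → p ≡ q ⊎ p < q
≤⇒≡⊎< {p} {q} p≤q with p <? q
... | yes p<q = inj₂ p<q
... | no p≮q  = inj₁ (≤-antisym p≤q (≮⇒≥ p≮q))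

0<p⊓q : ∀ {p q} → 0ℚ < p → 0ℚ < q → 0ℚ < p ⊓ q
0<p⊓q {p} {q} 0<p 0<q with ⊓-sel p q
... | inj₁ p⊓q≡p = subst (0ℚ <_) (sym p⊓q≡p) 0<p
... | inj₂ p⊓q≡q = subst (0ℚ <_) (sym p⊓q≡q) 0<q

ℕ→ℚ-≡-mkℚ : ∀ k → ℕ→ℚ k ≡ mkℚ (ℤ.+ k) 0 (Coprimality.sym (Coprimality.1-coprimeTo k))
ℕ→ℚ-≡-mkℚ k = normalize-coprime (Coprimality.sym (Coprimality.1-coprimeTo k))

ℕ→ℚ-+ : ∀ a b → ℕ→ℚ (a ℕ.+ b) ≡ ℕ→ℚ a + ℕ→ℚ b
ℕ→ℚ-+ a b = begin
  ℕ→ℚ (a ℕ.+ b)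
    ≡⟨ cong₂ (λ u v → (u ℤ.+ v) / 1) (ℤ.*-identityʳ (ℤ.+ a)) (ℤ.*-identityʳ (ℤ.+ b)) ⟨
  (ℤ.+ a ℤ.* ℤ.+ 1 ℤ.+ ℤ.+ b ℤ.* ℤ.+ 1) / 1
    ≡⟨ cong₂ _+_ (ℕ→ℚ-≡-mkℚ a) (ℕ→ℚ-≡-mkℚ b) ⟨
  ℕ→ℚ a + ℕ→ℚ b ∎
  where open ≡-Reasoning

ℕ→ℚ-suc : ∀ a → ℕ→ℚ (suc a) ≡ ℕ→ℚ a + 1ℚ
ℕ→ℚ-suc a = trans (cong ℕ→ℚ (ℕ.+-comm 1 a)) (ℕ→ℚ-+ a 1)

ℕ→ℚ-mono-≤ : ∀ {a b} → a ℕ.≤ b → ℕ→ℚ a ≤ ℕ→ℚ b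
ℕ→ℚ-mono-≤ {a} {b} a≤b rewrite ℕ→ℚ-≡-mkℚ a | ℕ→ℚ-≡-mkℚ b =
  *≤* (subst₂ ℤ._≤_ (sym (ℤ.*-identityʳ (ℤ.+ a))) (sym (ℤ.*-identityʳ (ℤ.+ b)))
              (ℤ.+≤+ a≤b))

ℕ→ℚ-<⇒suc-≤ : ∀ {a b} → ℕ→ℚ a < ℕ→ℚ b → ℕ→ℚ (suc a) ≤ ℕ→ℚ b
ℕ→ℚ-<⇒suc-≤ {a} {b} a<b with a ℕ.<? b
... | yes a<ℕb = ℕ→ℚ-mono-≤ a<ℕb
... | no a≮b = contradiction (<-≤-trans a<b (ℕ→ℚ-mono-≤ (ℕ.≮⇒≥ a≮b))) (<-irrefl refl)

ΣFin-ℕ→ℚ : ∀ {n} (f : Fin n → ℕ) → ΣFin (ℕ→ℚ ∘ f) ≡ ℕ→ℚ (foldr ℕ._+_ 0 f)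
ΣFin-ℕ→ℚ {zero} f = refl
ΣFin-ℕ→ℚ {suc n} f = trans (cong (ℕ→ℚ (f Fin.zero) +_) (ΣFin-ℕ→ℚ (f ∘ Fin.suc)))
                           (sym (ℕ→ℚ-+ (f Fin.zero) _))

ΣFin-cong : ∀ {n} {f g : Fin n → ℚ} → (∀ i → f i ≡ g i) → ΣFin f ≡ ΣFin g
ΣFin-cong {zero} f≗g = refl
ΣFin-cong {suc n} f≗g = cong₂ _+_ (f≗g Fin.zero) (ΣFin-cong (f≗g ∘ Fin.suc))

ΣFin-distrib-+ : ∀ {n} (f g : Fin n → ℚ) → ΣFin (λ i → f i + g i) ≡ ΣFin f + ΣFin g
ΣFin-distrib-+ {zero} f g = refl
ΣFin-distrib-+ {suc n} f g =
  trans (cong (f Fin.zero + g Fin.zero +_) (ΣFin-distrib-+ (f ∘ Fin.suc) (g ∘ Fin.suc)))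
        (solve 4 (λ a b c d → (a :+ b) :+ (c :+ d) := (a :+ c) :+ (b :+ d)) refl (f Fin.zero) (g Fin.zero) _ _)

ΣFin-distrib-minus : ∀ {n} (f g : Fin n → ℚ) → ΣFin (λ i → f i - g i) ≡ ΣFin f - ΣFin g
ΣFin-distrib-minus {zero} f g = refl
ΣFin-distrib-minus {suc n} f g =
  trans (cong (f Fin.zero - g Fin.zero +_) (ΣFin-distrib-minus (f ∘ Fin.suc) (g ∘ Fin.suc)))
        (solve 4 (λ a b c d → (a :- b) :+ (c :- d) := (a :+ c) :- (b :+ d)) refl (f Fin.zero) (g Fin.zero) _ _)

*-distribˡ-ΣFin : ∀ {n} c (f : Fin n → ℚ) → c * ΣFin f ≡ ΣFin (λ i → c * f i)
*-distribˡ-ΣFin {zero} c f = *-zeroʳ c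
*-distribˡ-ΣFin {suc n} c f =
  trans (*-distribˡ-+ c (f Fin.zero) _) (cong (c * f Fin.zero +_) (*-distribˡ-ΣFin c (f ∘ Fin.suc)))

ΣFin-zero : ∀ n → ΣFin {n} (λ _ → 0ℚ) ≡ 0ℚ
ΣFin-zero zero    = refl
ΣFin-zero (suc n) = trans (+-identityˡ _) (ΣFin-zero n)

ΣFin-mono-≤ : ∀ {n} {f g : Fin n → ℚ} → (∀ i → f i ≤ g i) → ΣFin f ≤ ΣFin g
ΣFin-mono-≤ {zero} f≤g = ≤-refl
ΣFin-mono-≤ {suc n} f≤g = +-mono-≤ (f≤g Fin.zero) (ΣFin-mono-≤ (f≤g ∘ Fin.suc))

ΣFin-nonneg : ∀ {n} {f : Fin n → ℚ} → (∀ i → 0ℚ ≤ f i) → 0ℚ ≤ ΣFin f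
ΣFin-nonneg {zero} 0≤f = ≤-refl
ΣFin-nonneg {suc n} 0≤f = +-mono-≤ (0≤f Fin.zero) (ΣFin-nonneg (0≤f ∘ Fin.suc))

term≤ΣFin : ∀ {n} {f : Fin n → ℚ} → (∀ i → 0ℚ ≤ f i) → ∀ j → f j ≤ ΣFin f
term≤ΣFin {suc n} {f} 0≤f Fin.zero    = p≤p+q (f Fin.zero) (ΣFin-nonneg (0≤f ∘ Fin.suc))
term≤ΣFin {suc n} {f} 0≤f (Fin.suc j) =
  subst (_≤ ΣFin f) (+-identityˡ _) (+-mono-≤ (0≤f Fin.zero) (term≤ΣFin (0≤f ∘ Fin.suc) j))

ΣFin-comm : ∀ {m n} (f : Fin m → Fin n → ℚ) →
            ΣFin (λ i → ΣFin (λ j → f i j)) ≡ ΣFin (λ j → ΣFin (λ i → f i j))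
ΣFin-comm {zero} {n} f = sym (ΣFin-zero n)
ΣFin-comm {suc m} f = trans (cong (ΣFin (f Fin.zero) +_) (ΣFin-comm (f ∘ Fin.suc)))
                            (sym (ΣFin-distrib-+ (f Fin.zero) _))

ΣFin-differ-at : ∀ {n} {f g : Fin n → ℚ} j {e} → (∀ i → i ≢ j → f i ≡ g i) → f j ≡ g j + e →
                 ΣFin f ≡ ΣFin g + e
ΣFin-differ-at {suc n} {f} {g} Fin.zero {e} f≗g fj≡gj+e =
  trans (cong₂ _+_ fj≡gj+e (ΣFin-cong (λ i → f≗g (Fin.suc i) λ ())))
        (solve 3 (λ a b c → (a :+ c) :+ b := (a :+ b) :+ c) refl (g Fin.zero) _ e)
ΣFin-differ-at {suc n} {f} {g} (Fin.suc j) {e} f≗g fj≡gj+e =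
  trans (cong₂ _+_ (f≗g Fin.zero λ ())
                   (ΣFin-differ-at j (λ i i≢j → f≗g (Fin.suc i) (i≢j ∘ suc-injective)) fj≡gj+e))
        (solve 3 (λ a b c → a :+ (b :+ c) := (a :+ b) :+ c) refl (g Fin.zero) _ e)

Σ<-cong : ∀ m {f g : ℕ → ℚ} → (∀ t → f t ≡ g t) → Σ< m f ≡ Σ< m g
Σ<-cong zero    f≗g = refl
Σ<-cong (suc m) f≗g = cong₂ _+_ (Σ<-cong m f≗g) (f≗g m)

Σ<-mono-≤ : ∀ m {f g : ℕ → ℚ} → (∀ t → t ℕ.< m → f t ≤ g t) → Σ< m f ≤ Σ< m g
Σ<-mono-≤ zero    f≤g = ≤-refl
Σ<-mono-≤ (suc m) f≤g =
  +-mono-≤ (Σ<-mono-≤ m (λ t t<m → f≤g t (ℕ.m<n⇒m<1+n t<m))) (f≤g m ℕ.≤-refl)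

Σ<-distrib-+ : ∀ m (f g : ℕ → ℚ) → Σ< m (λ t → f t + g t) ≡ Σ< m f + Σ< m g
Σ<-distrib-+ zero    f g = refl
Σ<-distrib-+ (suc m) f g =
  trans (cong (_+ (f m + g m)) (Σ<-distrib-+ m f g))
        (solve 4 (λ a b c d → (a :+ b) :+ (c :+ d) := (a :+ c) :+ (b :+ d)) refl (Σ< m f) (Σ< m g) (f m) (g m))

*-distribˡ-Σ< : ∀ m c (f : ℕ → ℚ) → c * Σ< m f ≡ Σ< m (λ t → c * f t)
*-distribˡ-Σ< zero    c f = *-zeroʳ c
*-distribˡ-Σ< (suc m) c f = trans (*-distribˡ-+ c (Σ< m f) (f m)) (cong (_+ c * f m) (*-distribˡ-Σ< m c f))

ΣFin-Σ<-comm : ∀ {n} m (f : Fin n → ℕ → ℚ) →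
               ΣFin (λ i → Σ< m (f i)) ≡ Σ< m (λ t → ΣFin (λ i → f i t))
ΣFin-Σ<-comm {n} zero    f = ΣFin-zero n
ΣFin-Σ<-comm (suc m) f = trans (ΣFin-distrib-+ (λ i → Σ< m (f i)) (λ i → f i m))
                               (cong (_+ ΣFin (λ i → f i m)) (ΣFin-Σ<-comm m f))

*-distribˡ-ΣFin-Σ< : ∀ {n} m c (f : Fin n → ℕ → ℚ) →
                     c * ΣFin (λ i → Σ< m (f i)) ≡ ΣFin (λ i → Σ< m (λ t → c * f i t))
*-distribˡ-ΣFin-Σ< m c f =
  trans (*-distribˡ-ΣFin c (λ i → Σ< m (f i))) (ΣFin-cong (λ i → *-distribˡ-Σ< m c (f i)))

length≤Σ< : ∀ m {f : ℕ → ℚ} → (∀ t → t ℕ.< m → 1ℚ ≤ f t) → ℕ→ℚ m ≤ Σ< m f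
length≤Σ< zero    1≤f = ≤-refl
length≤Σ< (suc m) {f} 1≤f =
  subst (_≤ Σ< (suc m) f) (sym (ℕ→ℚ-suc m))
        (+-mono-≤ (length≤Σ< m (λ t t<m → 1≤f t (ℕ.m<n⇒m<1+n t<m))) (1≤f m ℕ.≤-refl))

stepwise-antitone : ∀ {T} (f : ℕ → ℚ) → (∀ t → t ℕ.< T → f (suc t) ≤ f t) →
                    ∀ {s t} → s ℕ.≤ t → t ℕ.≤ T → f t ≤ f s
stepwise-antitone f step {t = zero}  ℕ.z≤n _ = ≤-refl
stepwise-antitone f step {t = suc t} s≤1+t 1+t≤T with ℕ.m≤n⇒m<n∨m≡n s≤1+t
... | inj₂ refl  = ≤-refl
... | inj₁ s<1+t =
  ≤-trans (step t 1+t≤T) (stepwise-antitone f step (ℕ.m<1+n⇒m≤n s<1+t) (ℕ.<⇒≤ 1+t≤T))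

Σ<-by-parts : ∀ m c (y : ℕ → ℚ) →
  Σ< (suc m) (λ t → c - Σ< t y) ≡ Σ< m (λ t → ℕ→ℚ (suc t) * y t) + ℕ→ℚ (suc m) * (c - Σ< m y)
Σ<-by-parts zero    c y =
  solve 1 (λ c → con 0ℚ :+ (c :- con 0ℚ) := con 0ℚ :+ con 1ℚ :* (c :- con 0ℚ)) refl c
Σ<-by-parts (suc m) c y = begin
  Σ< (suc m) (λ t → c - Σ< t y) + (c - (S + y m))
    ≡⟨ cong (_+ (c - (S + y m))) (Σ<-by-parts m c y) ⟩
  (P + a * (c - S)) + (c - (S + y m))
    ≡⟨ solve 5 (λ P a c S y → (P :+ a :* (c :- S)) :+ (c :- (S :+ y))
                           := (P :+ a :* y) :+ (a :+ con 1ℚ) :* (c :- (S :+ y))) refl P a c S (y m) ⟩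
  (P + a * y m) + (a + 1ℚ) * (c - (S + y m))
    ≡⟨ cong (λ b → (P + a * y m) + b * (c - (S + y m))) (sym (ℕ→ℚ-suc (suc m))) ⟩
  (P + a * y m) + ℕ→ℚ (suc (suc m)) * (c - (S + y m)) ∎
  where
  open ≡-Reasoning
  S = Σ< m y
  P = Σ< m (λ t → ℕ→ℚ (suc t) * y t)
  a = ℕ→ℚ (suc m)

module _ {n} (x : Matrix n) (i j : Fin n) (e : ℚ) where

  bump-≡ : bump x i j e i j ≡ x i j + e
  bump-≡ with i ≟ i | j ≟ j
  ... | yes _  | yes _  = refl
  ... | yes _  | no j≢j = contradiction refl j≢j
  ... | no i≢i | _      = contradiction refl i≢i

  bump-≢ : ∀ {k l} → k ≢ i ⊎ l ≢ j → bump x i j e k l ≡ x k l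
  bump-≢ {k} {l} k≢i⊎l≢j with k ≟ i | l ≟ j
  ... | no _    | _       = refl
  ... | yes _   | no _    = refl
  ... | yes k≡i | yes l≡j = [ contradiction k≡i , contradiction l≡j ] k≢i⊎l≢j

  rowSum-bump-≡ : rowSum (bump x i j e) i ≡ rowSum x i + e
  rowSum-bump-≡ = ΣFin-differ-at j (λ l l≢j → bump-≢ (inj₂ l≢j)) bump-≡

  rowSum-bump-≢ : ∀ {k} → k ≢ i → rowSum (bump x i j e) k ≡ rowSum x k
  rowSum-bump-≢ {k} k≢i = ΣFin-cong {f = bump x i j e k} {g = x k} (λ l → bump-≢ (inj₁ k≢i))

  colSum-bump-≡ : colSum (bump x i j e) j ≡ colSum x j + e
  colSum-bump-≡ = ΣFin-differ-at i (λ k k≢i → bump-≢ (inj₁ k≢i)) bump-≡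

  colSum-bump-≢ : ∀ {l} → l ≢ j → colSum (bump x i j e) l ≡ colSum x l
  colSum-bump-≢ {l} l≢j =
    ΣFin-cong {f = λ k → bump x i j e k l} {g = λ k → x k l} (λ k → bump-≢ (inj₂ l≢j))

  bump-isFracMatching : ∀ {R} → IsFracMatchingOf R x → 0ℚ ≤ e → e ≤ R i j - x i j →
                        e ≤ 1ℚ - rowSum x i → e ≤ 1ℚ - colSum x j →
                        IsFracMatchingOf R (bump x i j e)
  bump-isFracMatching {R} (0≤x , x≤R , row≤1 , col≤1) 0≤e e≤slack e≤row-slack e≤col-slack =
    0≤bump , bump≤R , bump-row≤1 , bump-col≤1
    where
    0≤bump : ∀ k l → 0ℚ ≤ bump x i j e k l
    0≤bump k l with k ≟ i | l ≟ j
    ... | yes refl | yes refl = ≤-trans (0≤x i j) (p≤p+q (x i j) 0≤e)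
    ... | yes _    | no _     = 0≤x k l
    ... | no _     | _        = 0≤x k l
    bump≤R : ∀ k l → bump x i j e k l ≤ R k l
    bump≤R k l with k ≟ i | l ≟ j
    ... | yes refl | yes refl = e≤q-p⇒p+e≤q (x i j) e≤slack
    ... | yes _    | no _     = x≤R k l
    ... | no _     | _        = x≤R k l
    -- Splitting on toSum (k ≟ i) rather than on k ≟ i leaves bump unreduced, so that
    -- rowSum-bump-≡ still applies.
    bump-row≤1 : ∀ k → rowSum (bump x i j e) k ≤ 1ℚ
    bump-row≤1 k with toSum (k ≟ i)
    ... | inj₁ refl = subst (_≤ 1ℚ) (sym rowSum-bump-≡) (e≤q-p⇒p+e≤q (rowSum x i) e≤row-slack)
    ... | inj₂ k≢i = subst (_≤ 1ℚ) (sym (rowSum-bump-≢ k≢i)) (row≤1 k)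
    bump-col≤1 : ∀ l → colSum (bump x i j e) l ≤ 1ℚ
    bump-col≤1 l with toSum (l ≟ j)
    ... | inj₁ refl = subst (_≤ 1ℚ) (sym colSum-bump-≡) (e≤q-p⇒p+e≤q (colSum x j) e≤col-slack)
    ... | inj₂ l≢j = subst (_≤ 1ℚ) (sym (colSum-bump-≢ l≢j)) (col≤1 l)

maximal⇒saturated : ∀ {n} {R x : Matrix n} → IsMaximalFracMatchingOf R x → ∀ i j →
                    x i j ≡ R i j ⊎ rowSum x i ≡ 1ℚ ⊎ colSum x j ≡ 1ℚ
maximal⇒saturated {R = R} {x} (matching@(_ , x≤R , row≤1 , col≤1) , unbumpable) i j
  with ≤⇒≡⊎< (x≤R i j) | ≤⇒≡⊎< (row≤1 i) | ≤⇒≡⊎< (col≤1 j)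
... | inj₁ x≡R | _          | _          = inj₁ x≡R
... | inj₂ _   | inj₁ row≡1 | _          = inj₂ (inj₁ row≡1)
... | inj₂ _   | inj₂ _     | inj₁ col≡1 = inj₂ (inj₂ col≡1)
... | inj₂ x<R | inj₂ row<1 | inj₂ col<1 =
  contradiction (bump-isFracMatching x i j e matching (<⇒≤ 0<e) e≤a e≤b (p⊓q≤q (a ⊓ b) c))
                (unbumpable i j e 0<e)
  where
  a = R i j - x i j
  b = 1ℚ - rowSum x i
  c = 1ℚ - colSum x j
  e = a ⊓ b ⊓ c
  0<e : 0ℚ < e
  0<e = 0<p⊓q (0<p⊓q (p<q⇒0<q-p x<R) (p<q⇒0<q-p row<1)) (p<q⇒0<q-p col<1)
  e≤a : e ≤ a
  e≤a = ≤-trans (p⊓q≤p (a ⊓ b) c) (p⊓q≤p a b)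
  e≤b : e ≤ b
  e≤b = ≤-trans (p⊓q≤p (a ⊓ b) c) (p⊓q≤q a b)

completionTime : ∀ {n} → (ℕ → Matrix n) → ℕ → Fin n → Fin n → ℚ
completionTime x T i j = Σ< T (λ t → ℕ→ℚ (suc t) * x t i j)

ALGcost≡ΣcompletionTime : ∀ {n} (x : ℕ → Matrix n) T →
  ALGcost x T ≡ ΣFin (λ i → ΣFin (λ j → completionTime x T i j))
ALGcost≡ΣcompletionTime x T = begin
  Σ< T (λ t → ℕ→ℚ (suc t) * ΣFin (λ i → ΣFin (x t i)))
    ≡⟨ Σ<-cong T (λ t → trans (*-distribˡ-ΣFin (ℕ→ℚ (suc t)) (λ i → ΣFin (x t i)))
                              (ΣFin-cong (λ i → *-distribˡ-ΣFin (ℕ→ℚ (suc t)) (x t i)))) ⟩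
  Σ< T (λ t → ΣFin (λ i → ΣFin (λ j → ℕ→ℚ (suc t) * x t i j)))
    ≡⟨ ΣFin-Σ<-comm T (λ i t → ΣFin (λ j → ℕ→ℚ (suc t) * x t i j)) ⟨
  ΣFin (λ i → Σ< T (λ t → ΣFin (λ j → ℕ→ℚ (suc t) * x t i j)))
    ≡⟨ ΣFin-cong (λ i → ΣFin-Σ<-comm T (λ j t → ℕ→ℚ (suc t) * x t i j)) ⟨
  ΣFin (λ i → ΣFin (λ j → completionTime x T i j)) ∎
  where open ≡-Reasoning

module _ {n} (D : Fin n → Fin n → ℕ) (x : ℕ → Matrix n) where

  Residual-suc : ∀ t i j → Residual D x (suc t) i j ≡ Residual D x t i j - x t i j
  Residual-suc t i j = solve 3 (λ d σ y → d :- (σ :+ y) := (d :- σ) :- y) refl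
                               (ℕ→ℚ (D i j)) (Σ< t (λ s → x s i j)) (x t i j)

  DS-zero : ∀ i → DS D x 0 i ≡ ℕ→ℚ (foldr ℕ._+_ 0 (D i))
  DS-zero i = trans (ΣFin-cong (λ j → +-identityʳ (ℕ→ℚ (D i j)))) (ΣFin-ℕ→ℚ (D i))

  Σ<-rowSum : ∀ t i → Σ< t (λ s → rowSum (x s) i) ≡ DS D x 0 i - DS D x t i
  Σ<-rowSum t i = begin
    Σ< t (λ s → rowSum (x s) i)
      ≡⟨ ΣFin-Σ<-comm t (λ j s → x s i j) ⟨
    ΣFin (λ j → Σ< t (λ s → x s i j))
      ≡⟨ ΣFin-cong (λ j → solve 2 (λ d σ → σ := (d :- con 0ℚ) :- (d :- σ)) refl
                                  (ℕ→ℚ (D i j)) (Σ< t (λ s → x s i j))) ⟩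
    ΣFin (λ j → Residual D x 0 i j - Residual D x t i j)
      ≡⟨ ΣFin-distrib-minus (Residual D x 0 i) (Residual D x t i) ⟩
    DS D x 0 i - DS D x t i ∎
    where open ≡-Reasoning

  module _ (T : ℕ) (done : AllTransmitted (Residual D x T)) where

    Σ<-transmitted : ∀ i j → Σ< T (λ t → x t i j) ≡ ℕ→ℚ (D i j)
    Σ<-transmitted i j = sym (p-q≡0⇒p≡q (done i j))

    Σ<-Residual : ∀ i j → Σ< (suc T) (λ t → Residual D x t i j) ≡ completionTime x T i j
    Σ<-Residual i j = begin
      Σ< (suc T) (λ t → Residual D x t i j)
        ≡⟨ Σ<-by-parts T (ℕ→ℚ (D i j)) (λ t → x t i j) ⟩
      completionTime x T i j + ℕ→ℚ (suc T) * Residual D x T i j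
        ≡⟨ cong (λ r → completionTime x T i j + ℕ→ℚ (suc T) * r) (done i j) ⟩
      completionTime x T i j + ℕ→ℚ (suc T) * 0ℚ
        ≡⟨ solve 2 (λ c a → c :+ a :* con 0ℚ := c) refl (completionTime x T i j) (ℕ→ℚ (suc T)) ⟩
      completionTime x T i j ∎
      where open ≡-Reasoning

    ΣFin-Σ<-DS : ΣFin (λ i → Σ< (suc T) (λ t → DS D x t i)) ≡
                 ΣFin (λ i → ΣFin (λ j → completionTime x T i j))
    ΣFin-Σ<-DS = ΣFin-cong (λ i → trans (sym (ΣFin-Σ<-comm (suc T) (λ j t → Residual D x t i j)))
                                        (ΣFin-cong (Σ<-Residual i)))

-- Column sums of D(t) are, definitionally, row sums of the transposed run.
ΣFin-Σ<-DR : ∀ {n} (D : Fin n → Fin n → ℕ) (x : ℕ → Matrix n) T → AllTransmitted (Residual D x T) →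
             ΣFin (λ j → Σ< (suc T) (λ t → DR D x t j)) ≡
             ΣFin (λ i → ΣFin (λ j → completionTime x T i j))
ΣFin-Σ<-DR D x T done =
  trans (ΣFin-Σ<-DS (flip D) (flip ∘ x) T (flip done)) (sym (ΣFin-comm (completionTime x T)))

module GreedyRun {n} (D : Fin n → Fin n → ℕ) (x : ℕ → Matrix n) (T : ℕ)
                 (greedy : IsGreedyRun D x T) where

  private
    R = Residual D x

  αS αR : Fin n → Fin n → ℚ
  αS i j = DS D x 0 i
  αR i j = DR D x 0 j

  done : AllTransmitted (R T)
  done = proj₁ (proj₂ greedy)

  maximal : ∀ {t} → t ℕ.< T → IsMaximalFracMatchingOf (R t) (x t)
  maximal = proj₁ greedy _

  0≤x : ∀ {t} → t ℕ.< T → ∀ i j → 0ℚ ≤ x t i j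
  0≤x t<T = proj₁ (proj₁ (maximal t<T))

  x≤R : ∀ {t} → t ℕ.< T → ∀ i j → x t i j ≤ R t i j
  x≤R t<T = proj₁ (proj₂ (proj₁ (maximal t<T)))

  0≤R : ∀ {t} → t ℕ.< T → ∀ i j → 0ℚ ≤ R t i j
  0≤R t<T i j = ≤-trans (0≤x t<T i j) (x≤R t<T i j)

  R-antitone : ∀ i j {s t} → s ℕ.≤ t → t ℕ.≤ T → R t i j ≤ R s i j
  R-antitone i j = stepwise-antitone (λ t → R t i j)
    (λ t t<T → subst (_≤ R t i j) (sym (Residual-suc D x t i j)) (p-q≤p (R t i j) (0≤x t<T i j)))

  pending⇒1≤rowSum+colSum : ∀ {s} i j → s ℕ.< T → 0ℚ < R (suc s) i j →
                            1ℚ ≤ rowSum (x s) i + colSum (x s) j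
  pending⇒1≤rowSum+colSum {s} i j s<T pending with maximal⇒saturated (maximal s<T) i j
  ... | inj₁ x≡R = contradiction (subst (0ℚ <_) R≡0 pending) (<-irrefl refl)
    where
    R≡0 : R (suc s) i j ≡ 0ℚ
    R≡0 = trans (Residual-suc D x s i j) (trans (cong (λ y → R s i j - y) x≡R) (+-inverseʳ (R s i j)))
  ... | inj₂ (inj₁ row≡1) =
    subst (λ r → 1ℚ ≤ r + colSum (x s) j) (sym row≡1) (p≤p+q 1ℚ (ΣFin-nonneg (λ k → 0≤x s<T k j)))
  ... | inj₂ (inj₂ col≡1) =
    subst (λ c → 1ℚ ≤ rowSum (x s) i + c) (sym col≡1)
          (subst (_≤ rowSum (x s) i + 1ℚ) (+-identityˡ 1ℚ) (+-monoˡ-≤ 1ℚ (ΣFin-nonneg (0≤x s<T i))))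

  pending⇒suc≤αS+αR : ∀ {t} i j → t ℕ.< T → 0ℚ < R t i j → ℕ→ℚ (suc t) ≤ αS i j + αR i j
  pending⇒suc≤αS+αR {t} i j t<T pending =
    subst (ℕ→ℚ (suc t) ≤_) (sym load≡)
          (ℕ→ℚ-<⇒suc-≤ {t} {m} (subst (ℕ→ℚ t <_) load≡ t<load))
    where
    m = foldr ℕ._+_ 0 (D i) ℕ.+ foldr ℕ._+_ 0 (flip D j)
    load≡ : DS D x 0 i + DR D x 0 j ≡ ℕ→ℚ m
    load≡ = trans (cong₂ _+_ (DS-zero D x i) (DS-zero (flip D) (flip ∘ x) j))
                  (sym (ℕ→ℚ-+ (foldr ℕ._+_ 0 (D i)) (foldr ℕ._+_ 0 (flip D j))))
    busy : ∀ s → s ℕ.< t → 1ℚ ≤ rowSum (x s) i + colSum (x s) j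
    busy s s<t = pending⇒1≤rowSum+colSum i j (ℕ.<-trans s<t t<T)
                   (<-≤-trans pending (R-antitone i j s<t (ℕ.<⇒≤ t<T)))
    t<load : ℕ→ℚ t < DS D x 0 i + DR D x 0 j
    t<load = begin-strict
      ℕ→ℚ t
        ≤⟨ length≤Σ< t busy ⟩
      Σ< t (λ s → rowSum (x s) i + colSum (x s) j)
        ≡⟨ Σ<-distrib-+ t (λ s → rowSum (x s) i) (λ s → colSum (x s) j) ⟩
      Σ< t (λ s → rowSum (x s) i) + Σ< t (λ s → colSum (x s) j)
        ≡⟨ cong₂ _+_ (Σ<-rowSum D x t i) (Σ<-rowSum (flip D) (flip ∘ x) t j) ⟩
      (DS D x 0 i - DS D x t i) + (DR D x 0 j - DR D x t j)
        <⟨ +-mono-< (p-q<p (DS D x 0 i) (<-≤-trans pending (term≤ΣFin (0≤R t<T i) j)))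
                    (p-q<p (DR D x 0 j) (<-≤-trans pending (term≤ΣFin (λ k → 0≤R t<T k j) i))) ⟩
      DS D x 0 i + DR D x 0 j ∎
      where open ≤-Reasoning

  completionTime≤[αS+αR]*D : ∀ i j → completionTime x T i j ≤ (αS i j + αR i j) * ℕ→ℚ (D i j)
  completionTime≤[αS+αR]*D i j = begin
    Σ< T (λ t → ℕ→ℚ (suc t) * x t i j)  ≤⟨ Σ<-mono-≤ T weight≤load ⟩
    Σ< T (λ t → load * x t i j)          ≡⟨ *-distribˡ-Σ< T load (λ t → x t i j) ⟨
    load * Σ< T (λ t → x t i j)          ≡⟨ cong (load *_) (Σ<-transmitted D x T done i j) ⟩
    load * ℕ→ℚ (D i j)                   ∎
    where
    open ≤-Reasoning
    load = αS i j + αR i j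
    weight≤load : ∀ t → t ℕ.< T → ℕ→ℚ (suc t) * x t i j ≤ load * x t i j
    weight≤load t t<T with ≤⇒≡⊎< (0≤x t<T i j)
    ... | inj₁ 0≡x = subst (λ y → ℕ→ℚ (suc t) * y ≤ load * y) 0≡x
                           (≤-reflexive (trans (*-zeroʳ (ℕ→ℚ (suc t))) (sym (*-zeroʳ load))))
    ... | inj₂ 0<x = *-monoʳ-≤-nonNeg (x t i j) {{nonNegative (<⇒≤ 0<x)}}
                       (pending⇒suc≤αS+αR i j t<T (<-≤-trans 0<x (x≤R t<T i j)))

  Dα : (Fin n → Fin n → ℚ) → Fin n → Fin n → ℚ
  Dα α i j = ℕ→ℚ (D i j) * α i j

  ΣDα : (Fin n → Fin n → ℚ) → ℚ
  ΣDα α = ΣFin (λ i → ΣFin (Dα α i))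

  ΣcompletionTime≤ΣDα : ΣFin (λ i → ΣFin (λ j → completionTime x T i j)) ≤ ΣDα αS + ΣDα αR
  ΣcompletionTime≤ΣDα = begin
    ΣFin (λ i → ΣFin (λ j → completionTime x T i j))
      ≤⟨ ΣFin-mono-≤ (λ i → ΣFin-mono-≤ (λ j →
           ≤-trans (completionTime≤[αS+αR]*D i j) (≤-reflexive (split i j)))) ⟩
    ΣFin (λ i → ΣFin (λ j → Dα αS i j + Dα αR i j))
      ≡⟨ ΣFin-cong (λ i → ΣFin-distrib-+ (Dα αS i) (Dα αR i)) ⟩
    ΣFin (λ i → ΣFin (Dα αS i) + ΣFin (Dα αR i))
      ≡⟨ ΣFin-distrib-+ (ΣFin ∘ Dα αS) (ΣFin ∘ Dα αR) ⟩
    ΣDα αS + ΣDα αR ∎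
    where
    open ≤-Reasoning
    split : ∀ i j → (αS i j + αR i j) * ℕ→ℚ (D i j) ≡ Dα αS i j + Dα αR i j
    split i j = solve 3 (λ s r d → (s :+ r) :* d := d :* s :+ d :* r) refl (αS i j) (αR i j) (ℕ→ℚ (D i j))

lemma1 : (n : ℕ) (D : Fin n → Fin n → ℕ) (x : ℕ → Matrix n) (T : ℕ) →
    IsGreedyRun D x T →
    let αS = λ (i j : Fin n) → DS D x 0 i
        αR = λ (i j : Fin n) → DR D x 0 j
        βS = λ (i : Fin n) (t : ℕ) → ¼ * DS D x t i
        βR = λ (j : Fin n) (t : ℕ) → ¼ * DR D x t j
    in ½ * ALGcost x T ≤
       ((ΣFin (λ i → ΣFin (λ j → ℕ→ℚ (D i j) * αS i j))
          - ΣFin (λ i → Σ< (suc T) (λ t → βS i t)))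
       + (ΣFin (λ i → ΣFin (λ j → ℕ→ℚ (D i j) * αR i j))
          - ΣFin (λ j → Σ< (suc T) (λ t → βR j t))))
lemma1 n D x T greedy = begin
  ½ * ALGcost x T            ≡⟨ cong (½ *_) (ALGcost≡ΣcompletionTime x T) ⟩
  ½ * W                      ≡⟨ solve 1 (λ W → con ½ :* W := W :- con ¼ :* W :- con ¼ :* W) refl W ⟩
  W - ¼ * W - ¼ * W          ≤⟨ +-monoˡ-≤ (- (¼ * W)) (+-monoˡ-≤ (- (¼ * W)) ΣcompletionTime≤ΣDα) ⟩
  A + B - ¼ * W - ¼ * W      ≡⟨ solve 3 (λ A B V → A :+ B :- V :- V := (A :- V) :+ (B :- V)) refl A B (¼ * W) ⟩
  (A - ¼ * W) + (B - ¼ * W)  ≡⟨ cong₂ (λ u v → (A - u) + (B - v)) ΣβS≡¼W ΣβR≡¼W ⟨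
  (A - ΣFin (λ i → Σ< (suc T) (λ t → ¼ * DS D x t i)))
    + (B - ΣFin (λ j → Σ< (suc T) (λ t → ¼ * DR D x t j))) ∎
  where
  open GreedyRun D x T greedy
  open ≤-Reasoning
  W = ΣFin (λ i → ΣFin (λ j → completionTime x T i j))
  A = ΣDα αS
  B = ΣDα αR
  ΣβS≡¼W : ΣFin (λ i → Σ< (suc T) (λ t → ¼ * DS D x t i)) ≡ ¼ * W
  ΣβS≡¼W = trans (sym (*-distribˡ-ΣFin-Σ< (suc T) ¼ (λ i t → DS D x t i)))
                 (cong (¼ *_) (ΣFin-Σ<-DS D x T done))
  ΣβR≡¼W : ΣFin (λ j → Σ< (suc T) (λ t → ¼ * DR D x t j)) ≡ ¼ * W
  ΣβR≡¼W = trans (sym (*-distribˡ-ΣFin-Σ< (suc T) ¼ (λ j t → DR D x t j)))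
                 (cong (¼ *_) (ΣFin-Σ<-DR D x T done))
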